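{- Every right-residuated l-groupoid of Łukasiewicz type is term equivalent to a basic algebra, and the right-residuated l-groupoids of Łukasiewicz type form a variety.
   Context: A right-residuated l-groupoid is an algebra $(L,\vee,\wedge,\odot,\rightarrow,0,1)$ of type $(2,2,2,2,0,0)$ such that $(L,\vee,\wedge)$ is a lattice with least element $0$ and greatest element $1$, $1\odot x=x$ for all $x$, and $x\odot y\le z$ iff $x\le y\rightarrow z$ for all $x,y,z$. It is integral if $1\odot x=x\odot 1=x$ for all $x$; with $\rceil x:=x\rightarrow 0$ it is involutive if $x\mapsto\rceil x$ is antitone and $\rceil\rceil x=x$. Its derived implication is $x\Rightarrow y:=\rceil y\rightarrow\rceil x$. It is of Łukasiewicz type if it is integral, involutive and satisfies $(x\Rightarrow y)\Rightarrow y=(y\Rightarrow x)\Rightarrow x$ for all $x,y$. A basic algebra is an algebra $(A,\oplus,\rceil,0)$ of type $(2,1,0)$ satisfying, for all $x,y,z$: $x\oplus 0=x$; $\rceil\rceil x=x$; $\rceil(\rceil x\oplus y)\oplus y=\rceil(\rceil y\oplus x)\oplus x$; $\rceil(\rceil(\rceil(x\oplus y)\oplus y)\oplus z)\oplus(x\oplus z)=1$, where $1:=\rceil 0$. -}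

module Defs where

open import Level using (Level; _⊔_) renaming (suc to lsuc; zero to lzero)
open import Data.Nat using (ℕ)
open import Data.Fin using (Fin; zero; suc)
open import Data.Product using (Σ; _×_; _,_)
open import Function.Bundles using (_⇔_)
open import Relation.Binary.PropositionalEquality using (_≡_)
open import Algebra.Lattice.Structures using (IsLattice)

-- Algebras of type (2,2,2,2,0,0): (L, ∨, ∧, ⊙, →, 0, 1)
-- (the residual → is written _⇀_ here)

record LSig (ℓ : Level) : Set (lsuc ℓ) where
  infixr 5 _⇀_
  infixr 6 _∨_
  infixr 7 _∧_
  infixl 8 _⊙_
  infix 4 _≤_
  field
    Carrier : Set ℓ
    _∨_ _∧_ _⊙_ _⇀_ : Carrier → Carrier → Carrier
    𝟘 𝟙 : Carrier

  _≤_ : Carrier → Carrier → Set ℓ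
  x ≤ y = x ∧ y ≡ x

  ⌉ : Carrier → Carrier
  ⌉ x = x ⇀ 𝟘

  _⇒_ : Carrier → Carrier → Carrier
  x ⇒ y = ⌉ y ⇀ ⌉ x

record IsRRLG {ℓ} (A : LSig ℓ) : Set ℓ where
  open LSig A
  field
    isLattice  : IsLattice _≡_ _∨_ _∧_
    least      : ∀ x → 𝟘 ≤ x
    greatest   : ∀ x → x ≤ 𝟙
    identityˡ  : ∀ x → 𝟙 ⊙ x ≡ x
    residuated : ∀ x y z → (x ⊙ y ≤ z) ⇔ (x ≤ y ⇀ z)

record IsŁukasiewiczType {ℓ} (A : LSig ℓ) : Set ℓ where
  open LSig A
  field
    isRRLG      : IsRRLG A
    integralˡ   : ∀ x → 𝟙 ⊙ x ≡ x
    integralʳ   : ∀ x → x ⊙ 𝟙 ≡ x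
    antitone    : ∀ x y → x ≤ y → ⌉ y ≤ ⌉ x
    involution  : ∀ x → ⌉ (⌉ x) ≡ x
    łukasiewicz : ∀ x y → (x ⇒ y) ⇒ y ≡ (y ⇒ x) ⇒ x

record BSig (ℓ : Level) : Set (lsuc ℓ) where
  infixl 6 _⊕_
  field
    Carrier : Set ℓ
    _⊕_ : Carrier → Carrier → Carrier
    ¬_  : Carrier → Carrier
    𝟘   : Carrier

  𝟙 : Carrier
  𝟙 = ¬ 𝟘

record IsBasicAlgebra {ℓ} (B : BSig ℓ) : Set ℓ where
  open BSig B
  field
    ax1 : ∀ x → x ⊕ 𝟘 ≡ x
    ax2 : ∀ x → ¬ (¬ x) ≡ x
    ax3 : ∀ x y → ¬ (¬ x ⊕ y) ⊕ y ≡ ¬ (¬ y ⊕ x) ⊕ x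
    ax4 : ∀ x y z → ¬ (¬ (¬ (x ⊕ y) ⊕ y) ⊕ z) ⊕ (x ⊕ z) ≡ 𝟙

data LTerm (n : ℕ) : Set where
  var : Fin n → LTerm n
  _∨ₜ_ _∧ₜ_ _⊙ₜ_ _⇀ₜ_ : LTerm n → LTerm n → LTerm n
  0ₜ 1ₜ : LTerm n

evalL : ∀ {ℓ n} (A : LSig ℓ) → LTerm n → (Fin n → LSig.Carrier A) → LSig.Carrier A
evalL A (var i)   ρ = ρ i
evalL A (s ∨ₜ t)  ρ = LSig._∨_ A (evalL A s ρ) (evalL A t ρ)
evalL A (s ∧ₜ t)  ρ = LSig._∧_ A (evalL A s ρ) (evalL A t ρ)
evalL A (s ⊙ₜ t)  ρ = LSig._⊙_ A (evalL A s ρ) (evalL A t ρ)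
evalL A (s ⇀ₜ t)  ρ = LSig._⇀_ A (evalL A s ρ) (evalL A t ρ)
evalL A 0ₜ        ρ = LSig.𝟘 A
evalL A 1ₜ        ρ = LSig.𝟙 A

data BTerm (n : ℕ) : Set where
  var : Fin n → BTerm n
  _⊕ₜ_ : BTerm n → BTerm n → BTerm n
  ¬ₜ_ : BTerm n → BTerm n
  0ₜ : BTerm n

evalB : ∀ {ℓ n} (B : BSig ℓ) → BTerm n → (Fin n → BSig.Carrier B) → BSig.Carrier B
evalB B (var i)  ρ = ρ i
evalB B (s ⊕ₜ t) ρ = BSig._⊕_ B (evalB B s ρ) (evalB B t ρ)
evalB B (¬ₜ s)   ρ = BSig.¬_ B (evalB B s ρ)
evalB B 0ₜ       ρ = BSig.𝟘 B

env0 : ∀ {a} {X : Set a} → Fin 0 → X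
env0 ()

env1 : ∀ {a} {X : Set a} → X → Fin 1 → X
env1 x zero = x

env2 : ∀ {a} {X : Set a} → X → X → Fin 2 → X
env2 x y zero = x
env2 x y (suc zero) = y

inducedB : ∀ {ℓ} (A : LSig ℓ) → LTerm 2 → LTerm 1 → LTerm 0 → BSig ℓ
inducedB A p⊕ p¬ p0 = record
  { Carrier = LSig.Carrier A
  ; _⊕_ = λ x y → evalL A p⊕ (env2 x y)
  ; ¬_  = λ x → evalL A p¬ (env1 x)
  ; 𝟘   = evalL A p0 env0
  }

-- A is term equivalent to a basic algebra: there are A-terms defining
-- operations ⊕, ⌉, 0 on the carrier of A making it a basic algebra B, and
-- every fundamental operation of A is a term operation of B.
-- (Then the clones of A and B coincide.)
record TermEquivalentToBasicAlgebra {ℓ} (A : LSig ℓ) : Set ℓ where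
  open LSig A
  field
    p⊕ : LTerm 2
    p¬ : LTerm 1
    p0 : LTerm 0
  B : BSig ℓ
  B = inducedB A p⊕ p¬ p0
  field
    isBasic : IsBasicAlgebra B
    q∨ q∧ q⊙ q⇀ : BTerm 2
    q0 q1 : BTerm 0
    ∨-def : ∀ x y → evalB B q∨ (env2 x y) ≡ x ∨ y
    ∧-def : ∀ x y → evalB B q∧ (env2 x y) ≡ x ∧ y
    ⊙-def : ∀ x y → evalB B q⊙ (env2 x y) ≡ x ⊙ y
    ⇀-def : ∀ x y → evalB B q⇀ (env2 x y) ≡ x ⇀ y
    0-def : evalB B q0 env0 ≡ 𝟘
    1-def : evalB B q1 env0 ≡ 𝟙

Identity : Set
Identity = Σ ℕ λ n → LTerm n × LTerm n

_⊨_ : ∀ {ℓ} → LSig ℓ → Identity → Set ℓ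
A ⊨ (n , s , t) = ∀ (ρ : Fin n → LSig.Carrier A) → evalL A s ρ ≡ evalL A t ρ

-- A class of algebras (given by a predicate) is a variety iff it is the
-- class of models of some set of identities (Birkhoff).
IsVariety : ∀ {ℓ} → (LSig ℓ → Set ℓ) → Set (lsuc ℓ)
IsVariety {ℓ} K =
  Σ (Identity → Set) λ E →
    ∀ (A : LSig ℓ) → K A ⇔ (∀ e → E e → A ⊨ e)

-- In an involutive right-residuated l-groupoid the derived implication
-- x ⇒ y = ⌉y → ⌉x is antitone in x and satisfies x ≤ y ⇒ x; the Łukasiewicz
-- identity then makes (x ⇒ y) ⇒ y the join x ∨ y, and from this x ≤ y ⇒ z
-- iff y ≤ x ⇒ z.  Hence every operation is a term in x ⊕ y := ⌉y → x and ⌉: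
-- x ∨ y = (x ⇒ y) ⇒ y, x ∧ y = ⌉(⌉x ∨ ⌉y), x ⊙ y = ⌉(x ⇒ ⌉y), x → y = y ⊕ ⌉x,
-- and the basic-algebra axioms follow.  For the variety, residuation is
-- replaced by the usual equational characterisation of a Galois connection:
-- the unit x ≤ y → x ⊙ y, the counit (y → z) ⊙ y ≤ z and monotonicity.
module Submission where

open import Defs
open import Level using (Level)
open import Data.Product using (_×_; _,_)
open import Data.Vec using (_∷_; []; lookup)
open import Data.Fin using (zero; suc)
open import Function.Bundles using (_⇔_; mk⇔; Equivalence)
open import Relation.Binary.PropositionalEquality
open import Relation.Binary.Bundles using (Poset)
open import Algebra.Lattice.Structures using (IsLattice)
open import Algebra.Lattice.Bundles using (Lattice)
open import Algebra.Lattice.Properties.Lattice using (∨-∧-orderTheoreticLattice)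
import Relation.Binary.Lattice as OrderTheoretic
import Relation.Binary.Reasoning.PartialOrder as PartialOrderReasoning

module LatticeOrder {ℓ} (A : LSig ℓ) (isLattice : IsLattice _≡_ (LSig._∨_ A) (LSig._∧_ A)) where
  open LSig A

  -- The library orders a lattice by x ≈ x ∧ y, the mirror image of _≤_.
  private
    lattice : Lattice ℓ ℓ
    lattice = record { isLattice = isLattice }

    module Std = OrderTheoretic.Lattice (∨-∧-orderTheoreticLattice lattice)

  ≤-refl : ∀ {x} → x ≤ x
  ≤-refl = sym Std.refl

  ≤-reflexive : ∀ {x y} → x ≡ y → x ≤ y
  ≤-reflexive refl = ≤-refl

  ≤-trans : ∀ {x y z} → x ≤ y → y ≤ z → x ≤ z
  ≤-trans p q = sym (Std.trans (sym p) (sym q))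

  ≤-antisym : ∀ {x y} → x ≤ y → y ≤ x → x ≡ y
  ≤-antisym p q = Std.antisym (sym p) (sym q)

  x≤x∨y : ∀ x y → x ≤ x ∨ y
  x≤x∨y x y = sym (Std.x≤x∨y x y)

  y≤x∨y : ∀ x y → y ≤ x ∨ y
  y≤x∨y x y = sym (Std.y≤x∨y x y)

  ∨-least : ∀ {x y z} → x ≤ z → y ≤ z → x ∨ y ≤ z
  ∨-least p q = sym (Std.∨-least (sym p) (sym q))

  x∧y≤x : ∀ x y → x ∧ y ≤ x
  x∧y≤x x y = sym (Std.x∧y≤x x y)

  x∧y≤y : ∀ x y → x ∧ y ≤ y
  x∧y≤y x y = sym (Std.x∧y≤y x y)

  ∧-greatest : ∀ {x y z} → x ≤ y → x ≤ z → x ≤ y ∧ z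
  ∧-greatest p q = sym (Std.∧-greatest (sym p) (sym q))

  x≤y⇒x∨y≡y : ∀ {x y} → x ≤ y → x ∨ y ≡ y
  x≤y⇒x∨y≡y p = ≤-antisym (∨-least p ≤-refl) (y≤x∨y _ _)

  ≤-poset : Poset ℓ ℓ ℓ
  ≤-poset = record
    { _≈_ = _≡_
    ; _≤_ = _≤_
    ; isPartialOrder = record
      { isPreorder = record
        { isEquivalence = isEquivalence
        ; reflexive = ≤-reflexive
        ; trans = ≤-trans
        }
      ; antisym = ≤-antisym
      }
    }

  module ≤-Reasoning = PartialOrderReasoning ≤-poset

  residuation-from-unit-counit :
    (∀ x y → x ≤ y ⇀ x ⊙ y) →
    (∀ y z → (y ⇀ z) ⊙ y ≤ z) →
    (∀ {x w} y → x ≤ w → x ⊙ y ≤ w ⊙ y) →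
    (∀ {z w} y → z ≤ w → y ⇀ z ≤ y ⇀ w) →
    ∀ x y z → (x ⊙ y ≤ z) ⇔ (x ≤ y ⇀ z)
  residuation-from-unit-counit unit counit ⊙-monoˡ ⇀-monoʳ x y z =
    mk⇔ (λ p → ≤-trans (unit x y) (⇀-monoʳ y p))
        (λ p → ≤-trans (⊙-monoˡ y p) (counit y z))

module Residuated {ℓ} {A : LSig ℓ} (isRRLG : IsRRLG A) where
  open LSig A
  open IsRRLG isRRLG
  open LatticeOrder A isLattice public

  ⇀-intro : ∀ {x y z} → x ⊙ y ≤ z → x ≤ y ⇀ z
  ⇀-intro = Equivalence.to (residuated _ _ _)

  ⇀-elim : ∀ {x y z} → x ≤ y ⇀ z → x ⊙ y ≤ z
  ⇀-elim = Equivalence.from (residuated _ _ _)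

  ⇀-unit : ∀ x y → x ≤ y ⇀ x ⊙ y
  ⇀-unit _ _ = ⇀-intro ≤-refl

  ⇀-counit : ∀ y z → (y ⇀ z) ⊙ y ≤ z
  ⇀-counit _ _ = ⇀-elim ≤-refl

  ⊙-monoˡ : ∀ {x w} y → x ≤ w → x ⊙ y ≤ w ⊙ y
  ⊙-monoˡ y p = ⇀-elim (≤-trans p (⇀-unit _ y))

  ⇀-monoʳ : ∀ {z w} y → z ≤ w → y ⇀ z ≤ y ⇀ w
  ⇀-monoʳ y p = ⇀-intro (≤-trans (⇀-counit y _) p)

  𝟙≤x⇒x≡𝟙 : ∀ {x} → 𝟙 ≤ x → x ≡ 𝟙
  𝟙≤x⇒x≡𝟙 p = ≤-antisym (greatest _) p

  ⌉𝟘≡𝟙 : ⌉ 𝟘 ≡ 𝟙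
  ⌉𝟘≡𝟙 = 𝟙≤x⇒x≡𝟙 (⇀-intro (≤-reflexive (identityˡ 𝟘)))

record IsInvolutive {ℓ} (A : LSig ℓ) : Set ℓ where
  open LSig A
  field
    isRRLG     : IsRRLG A
    antitone   : ∀ x y → x ≤ y → ⌉ y ≤ ⌉ x
    involution : ∀ x → ⌉ (⌉ x) ≡ x

module Involutive {ℓ} {A : LSig ℓ} (isInvolutive : IsInvolutive A) where
  open LSig A
  open IsInvolutive isInvolutive
  open IsRRLG isRRLG using (identityˡ; least)
  open Residuated isRRLG public

  ⌉-antitone : ∀ {x y} → x ≤ y → ⌉ y ≤ ⌉ x
  ⌉-antitone = antitone _ _

  x≤⌉y⇒y≤⌉x : ∀ {x y} → x ≤ ⌉ y → y ≤ ⌉ x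
  x≤⌉y⇒y≤⌉x {x} {y} p = subst (_≤ ⌉ x) (involution y) (⌉-antitone p)

  ⌉x≤y⇒⌉y≤x : ∀ {x y} → ⌉ x ≤ y → ⌉ y ≤ x
  ⌉x≤y⇒⌉y≤x {x} {y} p = subst (⌉ y ≤_) (involution x) (⌉-antitone p)

  ⌉𝟙≡𝟘 : ⌉ 𝟙 ≡ 𝟘
  ⌉𝟙≡𝟘 = trans (cong ⌉ (sym ⌉𝟘≡𝟙)) (involution 𝟘)

  ⌉x⇒⌉y≡y⇀x : ∀ x y → ⌉ x ⇒ ⌉ y ≡ y ⇀ x
  ⌉x⇒⌉y≡y⇀x x y = cong₂ _⇀_ (involution y) (involution x)

  x≤[y⇒x] : ∀ x y → x ≤ y ⇒ x
  x≤[y⇒x] x y = ⇀-intro (≤-trans (⇀-elim (≤-reflexive (sym (involution x)))) (least _))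

  ⇒-antitoneˡ : ∀ {x w} z → x ≤ w → w ⇒ z ≤ x ⇒ z
  ⇒-antitoneˡ z p = ⇀-monoʳ (⌉ z) (⌉-antitone p)

  𝟙⇒x≡x : ∀ x → 𝟙 ⇒ x ≡ x
  𝟙⇒x≡x x = trans (cong (⌉ x ⇀_) ⌉𝟙≡𝟘) (involution x)

  x≤y⇒[x⇒y]≡𝟙 : ∀ {x y} → x ≤ y → x ⇒ y ≡ 𝟙
  x≤y⇒[x⇒y]≡𝟙 {x} {y} p =
    𝟙≤x⇒x≡𝟙 (⇀-intro (subst (_≤ ⌉ x) (sym (identityˡ (⌉ y))) (⌉-antitone p)))

  ⌉[⌉x∨⌉y]≡x∧y : ∀ x y → ⌉ (⌉ x ∨ ⌉ y) ≡ x ∧ y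
  ⌉[⌉x∨⌉y]≡x∧y x y = ≤-antisym
    (∧-greatest (⌉x≤y⇒⌉y≤x (x≤x∨y (⌉ x) (⌉ y))) (⌉x≤y⇒⌉y≤x (y≤x∨y (⌉ x) (⌉ y))))
    (x≤⌉y⇒y≤⌉x (∨-least (⌉-antitone (x∧y≤x x y)) (⌉-antitone (x∧y≤y x y))))

module Łukasiewicz {ℓ} {A : LSig ℓ} (isŁukasiewicz : IsŁukasiewiczType A) where
  open LSig A
  open IsŁukasiewiczType isŁukasiewicz

  isInvolutive : IsInvolutive A
  isInvolutive = record { isRRLG = isRRLG ; antitone = antitone ; involution = involution }

  open Involutive isInvolutive public

  𝟙⇀x≡x : ∀ x → 𝟙 ⇀ x ≡ x
  𝟙⇀x≡x x = ≤-antisym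
    (subst (_≤ x) (integralʳ (𝟙 ⇀ x)) (⇀-counit 𝟙 x))
    (⇀-intro (≤-reflexive (integralʳ x)))

  x≤[x⇒y]⇒y : ∀ x y → x ≤ (x ⇒ y) ⇒ y
  x≤[x⇒y]⇒y x y = subst (x ≤_) (sym (łukasiewicz x y)) (x≤[y⇒x] x (y ⇒ x))

  [x⇒y]⇒y≡x∨y : ∀ x y → (x ⇒ y) ⇒ y ≡ x ∨ y
  [x⇒y]⇒y≡x∨y x y = ≤-antisym
    (begin
      (x ⇒ y) ⇒ y                ≤⟨ ⇒-antitoneˡ y (⇒-antitoneˡ y (x≤x∨y x y)) ⟩
      ((x ∨ y) ⇒ y) ⇒ y          ≡⟨ łukasiewicz (x ∨ y) y ⟩
      (y ⇒ (x ∨ y)) ⇒ (x ∨ y)    ≡⟨ cong (_⇒ (x ∨ y)) (x≤y⇒[x⇒y]≡𝟙 (y≤x∨y x y)) ⟩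
      𝟙 ⇒ (x ∨ y)                ≡⟨ 𝟙⇒x≡x (x ∨ y) ⟩
      x ∨ y                      ∎)
    (∨-least (x≤[x⇒y]⇒y x y) (x≤[y⇒x] y (x ⇒ y)))
    where open ≤-Reasoning

  ⇒-exchange : ∀ {x y z} → x ≤ y ⇒ z → y ≤ x ⇒ z
  ⇒-exchange {x} {y} {z} p = begin
    y                ≤⟨ x≤x∨y y z ⟩
    y ∨ z            ≡⟨ [x⇒y]⇒y≡x∨y y z ⟨
    (y ⇒ z) ⇒ z      ≤⟨ ⇒-antitoneˡ z p ⟩
    x ⇒ z            ∎
    where open ≤-Reasoning

  x⊙y≡⌉[x⇒⌉y] : ∀ x y → x ⊙ y ≡ ⌉ (x ⇒ ⌉ y)
  x⊙y≡⌉[x⇒⌉y] x y = ≤-antisym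
    (⇀-elim (subst (x ≤_) (cong (_⇀ ⌉ (x ⇒ ⌉ y)) (involution y)) (x≤[x⇒y]⇒y x (⌉ y))))
    (⌉x≤y⇒⌉y≤x (⇒-exchange (subst (x ≤_) (sym (⌉x⇒⌉y≡y⇀x (x ⊙ y) y)) (⇀-unit x y))))

  -- With this ⊕, ⌉x ⊕ y is x ⇒ y, so basic-algebra axiom 3 is the
  -- Łukasiewicz identity verbatim.
  _⊕_ : Carrier → Carrier → Carrier
  x ⊕ y = ⌉ y ⇀ x

  x⊕y≡⌉x⇒y : ∀ x y → x ⊕ y ≡ ⌉ x ⇒ y
  x⊕y≡⌉x⇒y x y = cong (⌉ y ⇀_) (sym (involution x))

  x⊕𝟘≡x : ∀ x → x ⊕ 𝟘 ≡ x
  x⊕𝟘≡x x = trans (cong (_⇀ x) ⌉𝟘≡𝟙) (𝟙⇀x≡x x)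

  [[x⊕y]⇒y]⇒z≤x⊕z : ∀ x y z → ((x ⊕ y) ⇒ y) ⇒ z ≤ x ⊕ z
  [[x⊕y]⇒y]⇒z≤x⊕z x y z = begin
    ((x ⊕ y) ⇒ y) ⇒ z   ≤⟨ ⇒-antitoneˡ z (subst (λ t → ⌉ x ≤ t ⇒ y) (sym (x⊕y≡⌉x⇒y x y))
                                                (x≤[x⇒y]⇒y (⌉ x) y)) ⟩
    ⌉ x ⇒ z             ≡⟨ x⊕y≡⌉x⇒y x z ⟨
    x ⊕ z               ∎
    where open ≤-Reasoning

  isBasicAlgebra : IsBasicAlgebra (record { Carrier = Carrier ; _⊕_ = _⊕_ ; ¬_ = ⌉ ; 𝟘 = 𝟘 })
  isBasicAlgebra = record
    { ax1 = x⊕𝟘≡x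
    ; ax2 = involution
    ; ax3 = łukasiewicz
    ; ax4 = λ x y z → trans (x≤y⇒[x⇒y]≡𝟙 ([[x⊕y]⇒y]⇒z≤x⊕z x y z)) (sym ⌉𝟘≡𝟙)
    }

termEquivalentToBasicAlgebra :
  ∀ {ℓ} (A : LSig ℓ) → IsŁukasiewiczType A → TermEquivalentToBasicAlgebra A
termEquivalentToBasicAlgebra A isŁukasiewicz = record
  { p⊕ = (var (suc zero) ⇀ₜ 0ₜ) ⇀ₜ var zero
  ; p¬ = var zero ⇀ₜ 0ₜ
  ; p0 = 0ₜ
  ; isBasic = isBasicAlgebra
  ; q∨ = (¬ₜ ((¬ₜ x) ⊕ₜ y)) ⊕ₜ y
  ; q∧ = ¬ₜ ((¬ₜ ((¬ₜ (¬ₜ x)) ⊕ₜ (¬ₜ y))) ⊕ₜ (¬ₜ y))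
  ; q⊙ = ¬ₜ ((¬ₜ x) ⊕ₜ (¬ₜ y))
  ; q⇀ = y ⊕ₜ (¬ₜ x)
  ; q0 = 0ₜ
  ; q1 = ¬ₜ 0ₜ
  ; ∨-def = [x⇒y]⇒y≡x∨y
  ; ∧-def = λ x y → trans (cong ⌉ ([x⇒y]⇒y≡x∨y (⌉ x) (⌉ y))) (⌉[⌉x∨⌉y]≡x∧y x y)
  ; ⊙-def = λ x y → sym (x⊙y≡⌉[x⇒⌉y] x y)
  ; ⇀-def = λ x y → cong (_⇀ y) (involution x)
  ; 0-def = refl
  ; 1-def = ⌉𝟘≡𝟙
  }
  where
  open LSig A using (⌉; _⇀_)
  open IsŁukasiewiczType isŁukasiewicz using (involution)
  open Łukasiewicz isŁukasiewicz
  x y : BTerm 2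
  x = var zero
  y = var (suc zero)

module Terms where
  x y z : LTerm 3
  x = var zero
  y = var (suc zero)
  z = var (suc (suc zero))

  ⌉ₜ : LTerm 3 → LTerm 3
  ⌉ₜ t = t ⇀ₜ 0ₜ

  _⇒ₜ_ : LTerm 3 → LTerm 3 → LTerm 3
  s ⇒ₜ t = ⌉ₜ t ⇀ₜ ⌉ₜ s

  _≐_ : LTerm 3 → LTerm 3 → Identity
  s ≐ t = 3 , s , t

  _≤ₜ_ : LTerm 3 → LTerm 3 → Identity
  s ≤ₜ t = (s ∧ₜ t) ≐ s

open Terms

data ŁukasiewiczAxiom : Identity → Set where
  ∨-comm        : ŁukasiewiczAxiom ((x ∨ₜ y) ≐ (y ∨ₜ x))
  ∨-assoc       : ŁukasiewiczAxiom (((x ∨ₜ y) ∨ₜ z) ≐ (x ∨ₜ (y ∨ₜ z)))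
  ∧-comm        : ŁukasiewiczAxiom ((x ∧ₜ y) ≐ (y ∧ₜ x))
  ∧-assoc       : ŁukasiewiczAxiom (((x ∧ₜ y) ∧ₜ z) ≐ (x ∧ₜ (y ∧ₜ z)))
  ∨-absorbs-∧   : ŁukasiewiczAxiom ((x ∨ₜ (x ∧ₜ y)) ≐ x)
  ∧-absorbs-∨   : ŁukasiewiczAxiom ((x ∧ₜ (x ∨ₜ y)) ≐ x)
  𝟘-least       : ŁukasiewiczAxiom (0ₜ ≤ₜ x)
  𝟙-greatest    : ŁukasiewiczAxiom (x ≤ₜ 1ₜ)
  ⊙-identityˡ   : ŁukasiewiczAxiom ((1ₜ ⊙ₜ x) ≐ x)
  ⊙-identityʳ   : ŁukasiewiczAxiom ((x ⊙ₜ 1ₜ) ≐ x)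
  ⌉-involutive  : ŁukasiewiczAxiom (⌉ₜ (⌉ₜ x) ≐ x)
  ⌉-antitone    : ŁukasiewiczAxiom (⌉ₜ (x ∨ₜ y) ≤ₜ ⌉ₜ x)
  łukasiewicz   : ŁukasiewiczAxiom (((x ⇒ₜ y) ⇒ₜ y) ≐ ((y ⇒ₜ x) ⇒ₜ x))
  ⇀-unit        : ŁukasiewiczAxiom (x ≤ₜ (y ⇀ₜ (x ⊙ₜ y)))
  ⇀-counit      : ŁukasiewiczAxiom (((y ⇀ₜ z) ⊙ₜ y) ≤ₜ z)
  ⊙-monoˡ       : ŁukasiewiczAxiom ((x ⊙ₜ y) ≤ₜ ((x ∨ₜ z) ⊙ₜ y))
  ⇀-monoʳ       : ŁukasiewiczAxiom ((y ⇀ₜ z) ≤ₜ (y ⇀ₜ (z ∨ₜ x)))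

module Soundness {ℓ} {A : LSig ℓ} (isŁukasiewicz : IsŁukasiewiczType A) where
  private
    module K = IsŁukasiewiczType isŁukasiewicz
    module R = IsRRLG K.isRRLG
    module L = IsLattice R.isLattice
    module Ł = Łukasiewicz isŁukasiewicz

  sound : ∀ e → ŁukasiewiczAxiom e → A ⊨ e
  sound _ ∨-comm       _ = L.∨-comm _ _
  sound _ ∨-assoc      _ = L.∨-assoc _ _ _
  sound _ ∧-comm       _ = L.∧-comm _ _
  sound _ ∧-assoc      _ = L.∧-assoc _ _ _
  sound _ ∨-absorbs-∧  _ = L.∨-absorbs-∧ _ _
  sound _ ∧-absorbs-∨  _ = L.∧-absorbs-∨ _ _
  sound _ 𝟘-least      _ = R.least _
  sound _ 𝟙-greatest   _ = R.greatest _
  sound _ ⊙-identityˡ  _ = K.integralˡ _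
  sound _ ⊙-identityʳ  _ = K.integralʳ _
  sound _ ⌉-involutive _ = K.involution _
  sound _ ⌉-antitone   _ = Ł.⌉-antitone (Ł.x≤x∨y _ _)
  sound _ łukasiewicz  _ = K.łukasiewicz _ _
  sound _ ⇀-unit       _ = Ł.⇀-unit _ _
  sound _ ⇀-counit     _ = Ł.⇀-counit _ _
  sound _ ⊙-monoˡ      _ = Ł.⊙-monoˡ _ (Ł.x≤x∨y _ _)
  sound _ ⇀-monoʳ      _ = Ł.⇀-monoʳ _ (Ł.x≤x∨y _ _)

module Completeness {ℓ} {A : LSig ℓ} (models : ∀ e → ŁukasiewiczAxiom e → A ⊨ e) where
  open LSig A

  holds : ∀ {s t} → ŁukasiewiczAxiom (3 , s , t) →
          ∀ a b c → evalL A s (lookup (a ∷ b ∷ c ∷ [])) ≡ evalL A t (lookup (a ∷ b ∷ c ∷ []))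
  holds ax a b c = models _ ax (lookup (a ∷ b ∷ c ∷ []))

  isLattice : IsLattice _≡_ _∨_ _∧_
  isLattice = record
    { isEquivalence = isEquivalence
    ; ∨-comm = λ a b → holds ∨-comm a b a
    ; ∨-assoc = holds ∨-assoc
    ; ∨-cong = cong₂ _∨_
    ; ∧-comm = λ a b → holds ∧-comm a b a
    ; ∧-assoc = holds ∧-assoc
    ; ∧-cong = cong₂ _∧_
    ; absorptive = (λ a b → holds ∨-absorbs-∧ a b a) , (λ a b → holds ∧-absorbs-∨ a b a)
    }

  open LatticeOrder A isLattice

  residuated : ∀ a b c → (a ⊙ b ≤ c) ⇔ (a ≤ b ⇀ c)
  residuated = residuation-from-unit-counit
    (λ a b → holds ⇀-unit a b a)
    (λ b c → holds ⇀-counit b b c)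
    (λ {a} {w} b p → subst (λ t → a ⊙ b ≤ t ⊙ b) (x≤y⇒x∨y≡y p) (holds ⊙-monoˡ a b w))
    (λ {c} {w} b p → subst (λ t → b ⇀ c ≤ b ⇀ t) (x≤y⇒x∨y≡y p) (holds ⇀-monoʳ w b c))

  isŁukasiewiczType : IsŁukasiewiczType A
  isŁukasiewiczType = record
    { isRRLG = record
      { isLattice = isLattice
      ; least = λ a → holds 𝟘-least a a a
      ; greatest = λ a → holds 𝟙-greatest a a a
      ; identityˡ = λ a → holds ⊙-identityˡ a a a
      ; residuated = residuated
      }
    ; integralˡ = λ a → holds ⊙-identityˡ a a a
    ; integralʳ = λ a → holds ⊙-identityʳ a a a
    ; antitone = λ a b p → subst (λ t → ⌉ t ≤ ⌉ a) (x≤y⇒x∨y≡y p) (holds ⌉-antitone a b a)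
    ; involution = λ a → holds ⌉-involutive a a a
    ; łukasiewicz = λ a b → holds łukasiewicz a b a
    }

corollary4 : ∀ {ℓ : Level} →
    ((A : LSig ℓ) → IsŁukasiewiczType A → TermEquivalentToBasicAlgebra A)
    × IsVariety {ℓ} IsŁukasiewiczType
corollary4 = termEquivalentToBasicAlgebra , (ŁukasiewiczAxiom , axiomatised)
  where
  axiomatised : ∀ A → IsŁukasiewiczType A ⇔ (∀ e → ŁukasiewiczAxiom e → A ⊨ e)
  axiomatised A = mk⇔ Soundness.sound Completeness.isŁukasiewiczType
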